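{- Every strongly blockwise decomposable constraint language is strongly balanced.
   Context: Fix a finite domain $D$. A constraint language is a finite set of relations $R\subseteq D^k$. A constraint $R(x_1,\dots,x_k)$ has scope $\tilde u$ and solutions the maps $\beta:\tilde u\to D$ with $(\beta(x_1),\dots,\beta(x_k))\in R$. $\langle\Gamma\rangle$ is the set of relations pp-definable over $\Gamma$ (projections of conjunctions of constraints with relations from $\Gamma$ and equality); a constraint is pp-definable if defined by such a formula. Projection $\pi_Y$ restricts solutions to $Y$; selection $R|_{x\in S}$ keeps solutions with $\beta(x)\in S$. $R(\vec u)$ is decomposable w.r.t. a partition $(V_1,\dots,V_\ell)$ of $\tilde u$ if it equals $\pi_{V_1}R(\vec u)\times\cdots\times\pi_{V_\ell}R(\vec u)$. For distinct $x,y\in\tilde u$ the selection matrix $M^R_{x,y}$ has entries $\pi_{\tilde u\setminus\{x,y\}}(R(\vec u)|_{x=a,y=b})$; it is a proper block matrix if there are pairwise disjoint nonempty $A_1,\dots,A_k$ and pairwise disjoint nonempty $B_1,\dots,B_k$ with entry $[a,b]$ nonempty iff $a\in A_\ell,b\in B_\ell$ for some $\ell$. $R(\vec u)$ is blockwise decomposable in $x,y$ if $M^R_{x,y}$ is a proper block matrix and each block constraint $R(\vec u)|_{x\in A_\ell,y\in B_\ell}$ is decomposable w.r.t. some partition $(V_\ell,W_\ell)$ of $\tilde u$ with $x\in V_\ell,y\in W_\ell$; blockwise decomposable if so for all pairs of distinct variables; a relation is if the constraint on distinct variables is. $\Gamma$ is strongly blockwise decomposable if every relation in $\langle\Gamma\rangle$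 is blockwise decomposable. A constraint $R(\vec x,\vec y,\vec z)$ is balanced (w.r.t. $\vec x;\vec y;\vec z$) if the $|D|^{|\vec x|}\times|D|^{|\vec y|}$ matrix $M^\#_{\vec x,\vec y}$ with $M^\#_{\vec x,\vec y}[\vec a,\vec b]=|\mathrm{sol}(R(\vec x,\vec y,\vec z)|_{\vec x=\vec a,\vec y=\vec b})|$ is a proper block matrix (i.e., its nonzero entries form blocks $A_\ell\times B_\ell$ with pairwise disjoint row sets and pairwise disjoint column sets) in which every block has rank one. $\Gamma$ is strongly balanced if every pp-definable constraint over $\Gamma$ of arity at least three is balanced. -}

module Defs where

open import Data.Nat using (ℕ; zero; suc; _+_; _*_; _≤_)
open import Data.Fin using (Fin; _≟_)
open import Data.Bool using (Bool; true; false; T; if_then_else_)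
open import Data.List using (List; []; _∷_; map; concatMap; allFin; length; lookup)
open import Data.Bool.ListAction using (any; all)
open import Data.Nat.ListAction using (sum)
open import Data.Vec using (Vec; []; _∷_; _++_) renaming (lookup to vlookup; map to vmap)
open import Data.Product using (Σ; ∃; _×_; _,_; proj₁; proj₂)
open import Relation.Nullary using (¬_)
open import Relation.Nullary.Decidable using (⌊_⌋)
open import Relation.Binary.PropositionalEquality using (_≡_; _≢_)

Rel : ℕ → Set
Rel d = Σ ℕ (λ k → Vec (Fin d) k → Bool)

arity : ∀ {d} → Rel d → ℕ
arity = proj₁

Language : ℕ → Set
Language d = List (Rel d)

allVec : (d m : ℕ) → List (Vec (Fin d) m)
allVec d zero = [] ∷ []
allVec d (suc m) = concatMap (λ x → map (x ∷_) (allVec d m)) (allFin d)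

data Atom {d : ℕ} (Γ : Language d) (v : ℕ) : Set where
  rel : (i : Fin (length Γ)) → Vec (Fin v) (arity (lookup Γ i)) → Atom Γ v
  eq  : Fin v → Fin v → Atom Γ v

-- A pp-formula with n free variables (Fin n, first) and nEx existentially
-- quantified variables (the remaining ones).
record PP {d : ℕ} (Γ : Language d) (n : ℕ) : Set where
  constructor pp
  field
    nEx   : ℕ
    atoms : List (Atom Γ (n + nEx))

evalAtom : ∀ {d} {Γ : Language d} {v} → Vec (Fin d) v → Atom Γ v → Bool
evalAtom {Γ = Γ} β (rel i xs) = proj₂ (lookup Γ i) (vmap (vlookup β) xs)
evalAtom β (eq i j) = ⌊ vlookup β i ≟ vlookup β j ⌋

sat : ∀ {d} {Γ : Language d} {n} → PP Γ n → Vec (Fin d) n → Bool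
sat {d} (pp m as) a = any (λ w → all (evalAtom (a ++ w)) as) (allVec d m)

count : ∀ {d m} → (Vec (Fin d) m → Bool) → ℕ
count {d} {m} P = sum (map (λ c → if P c then 1 else 0) (allVec d m))

-- Proper block matrix structure on a matrix with rows Rw, columns Cl,
-- where nz a b says that entry [a,b] is nonzero / nonempty.
record ProperBlock (Rw Cl : Set) (nz : Rw → Cl → Set) : Set where
  field
    k      : ℕ
    A      : Fin k → Rw → Bool
    B      : Fin k → Cl → Bool
    A-disj : ∀ ℓ ℓ' a → T (A ℓ a) → T (A ℓ' a) → ℓ ≡ ℓ'
    B-disj : ∀ ℓ ℓ' b → T (B ℓ b) → T (B ℓ' b) → ℓ ≡ ℓ'
    A-ne   : ∀ ℓ → ∃ λ a → T (A ℓ a)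
    B-ne   : ∀ ℓ → ∃ λ b → T (B ℓ b)
    blocks⇒ : ∀ a b → nz a b → ∃ λ ℓ → T (A ℓ a) × T (B ℓ b)
    blocks⇐ : ∀ a b ℓ → T (A ℓ a) → T (B ℓ b) → nz a b

-- A constraint with solution set S ⊆ D^n (variables Fin n) is decomposable
-- w.r.t. the partition (V, complement of V): S = π_V S × π_W S.
Decomposable : ∀ {d n} → (Vec (Fin d) n → Set) → (Fin n → Bool) → Set
Decomposable {d} {n} S V =
  ∀ (β : Vec (Fin d) n) →
    (S β → Σ (Vec (Fin d) n) λ β₁ → Σ (Vec (Fin d) n) λ β₂ →
             S β₁ × S β₂ ×
             (∀ i → V i ≡ true  → vlookup β i ≡ vlookup β₁ i) ×
             (∀ i → V i ≡ false → vlookup β i ≡ vlookup β₂ i))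
  × ((Σ (Vec (Fin d) n) λ β₁ → Σ (Vec (Fin d) n) λ β₂ →
             S β₁ × S β₂ ×
             (∀ i → V i ≡ true  → vlookup β i ≡ vlookup β₁ i) ×
             (∀ i → V i ≡ false → vlookup β i ≡ vlookup β₂ i)) → S β)

SelNonempty : ∀ {d n} → (Vec (Fin d) n → Bool) → Fin n → Fin n → Fin d → Fin d → Set
SelNonempty {d} {n} R x y a b =
  ∃ λ (β : Vec (Fin d) n) → T (R β) × vlookup β x ≡ a × vlookup β y ≡ b

BlockwiseDecomposableIn : ∀ {d n} → (Vec (Fin d) n → Bool) → Fin n → Fin n → Set
BlockwiseDecomposableIn {d} {n} R x y =
  Σ (ProperBlock (Fin d) (Fin d) (SelNonempty R x y)) λ P →
    let open ProperBlock P in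
    ∀ ℓ → ∃ λ (V : Fin n → Bool) → V x ≡ true × V y ≡ false ×
      Decomposable (λ β → T (R β) × T (A ℓ (vlookup β x)) × T (B ℓ (vlookup β y))) V

BlockwiseDecomposable : ∀ {d n} → (Vec (Fin d) n → Bool) → Set
BlockwiseDecomposable {d} {n} R = ∀ (x y : Fin n) → x ≢ y → BlockwiseDecomposableIn R x y

StronglyBlockwiseDecomposable : ∀ {d} → Language d → Set
StronglyBlockwiseDecomposable Γ = ∀ n (φ : PP Γ n) → BlockwiseDecomposable (sat φ)

CountMatrix : ∀ {d} p q r → (Vec (Fin d) (p + q + r) → Bool) → Vec (Fin d) p → Vec (Fin d) q → ℕ
CountMatrix p q r R a b = count (λ c → R ((a ++ b) ++ c))

-- Balanced: M^# is a proper block matrix each of whose blocks has rank one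
-- (all entries of a block are nonzero, so rank one = all 2x2 minors vanish).
Balanced : ∀ {d} p q r → (Vec (Fin d) (p + q + r) → Bool) → Set
Balanced {d} p q r R =
  Σ (ProperBlock (Vec (Fin d) p) (Vec (Fin d) q) (λ a b → ¬ (M a b ≡ 0))) λ P →
    let open ProperBlock P in
    ∀ ℓ a a' b b' → T (A ℓ a) → T (A ℓ a') → T (B ℓ b) → T (B ℓ b') →
      M a b * M a' b' ≡ M a b' * M a' b
  where M = CountMatrix p q r R

-- Every pp-definable constraint of arity ≥ 3 is balanced w.r.t. every split of
-- its (distinct) scope variables into x;y;z (by renaming, x = first p, y = next q,
-- z = last r variables).
StronglyBalanced : ∀ {d} → Language d → Set
StronglyBalanced Γ = ∀ p q r → 3 ≤ p + q + r → (φ : PP Γ (p + q + r)) → Balanced p q r (sat φ)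

{-# OPTIONS --safe #-}
-- Fix a column b of the counting matrix M of R(x,y,z). The pp-definable constraint
-- R(x,y,z) ∧ R(x,y',z') with y' = b has all its solutions in one block of the selection
-- matrix of (x_i, y_j), since their (x_i, b_j) entries share the column b_j; decomposing that
-- block gives a mask, with x_i on and y_j off, along which these solutions are closed under
-- mixing two tuples. Intersections and unions of such masks yield one mask W on z with
--   R(a,b₁,c), R(a',b₂,c') ⟹ R(a, b₂, mix_W c c')   whenever M[a,b], M[a',b] ≠ 0.
-- This makes the support of M rectangular, hence a proper block matrix, and turns the
-- involution (c,c') ↦ (mix_W c c', mix_W c' c) into a bijection between the solution pairs
-- counted by M[a,b]·M[a',b'] and by M[a,b']·M[a',b], so every block has rank one.
module Submission where

open import Data.Bool using (Bool; true; false; T; if_then_else_; _∧_; _∨_)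
open import Data.Bool.ListAction using (any; all)
open import Data.Bool.Properties using (∧-zeroʳ; ∨-zeroʳ; ∧-assoc; T-∧)
open import Data.Empty using (⊥-elim)
open import Data.Fin using (Fin; zero; suc; _↑ˡ_; _↑ʳ_)
open import Data.Fin.Properties using (suc-injective; ↑ˡ-injective)
open import Data.List
  using (List; []; _∷_; map; concatMap; allFin; length; lookup; filterᵇ; deduplicate; deduplicateᵇ)
  renaming (_++_ to _++ₗ_)
open import Data.List.Membership.Propositional using (_∈_; lose)
open import Data.List.Membership.Propositional.Properties
  using (∈-lookup; ∈-filter⁺; ∈-map⁺; ∈-concatMap⁺; ∈-allFin)
open import Data.List.Relation.Unary.All as All using (All)
import Data.List.Relation.Unary.All.Properties as All
open import Data.List.Relation.Unary.AllPairs using (AllPairs; []; _∷_)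
import Data.List.Relation.Unary.AllPairs.Properties as AllPairs
open import Data.List.Relation.Unary.Any as Any using (Any; here; satisfied; index)
open import Data.List.Relation.Unary.Any.Properties using (any⁺; any⁻; lookup-index)
import Data.List.Relation.Unary.Any.Properties as Any
open import Data.Nat as ℕ using (ℕ; _+_; _*_)
open import Data.Nat.ListAction using (sum)
open import Data.Nat.Properties
  using (+-assoc; +-identityʳ; *-zeroʳ; *-distribˡ-+; *-distribʳ-+; +-commutativeSemigroup)
open import Algebra.Properties.CommutativeSemigroup +-commutativeSemigroup using (interchange)
open import Data.Product using (∃; _×_; _,_; proj₁; proj₂)
open import Data.Vec using (Vec; []; _∷_; _++_; splitAt) renaming (lookup to vlookup; map to vmap)
import Data.Vec as Vec
open import Data.Vec.Properties
  using (lookup-++ˡ; lookup-++ʳ; map-∘; map-cong; map-++; lookup-map; map-lookup-allFin)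
open import Function using (_∘_)
open import Function.Bundles using (_⇔_; mk⇔; Equivalence)
open import Relation.Binary using (Symmetric; Decidable)
open import Relation.Binary.PropositionalEquality
  using (_≡_; _≢_; refl; sym; trans; cong; cong₂; subst; subst₂)
open import Relation.Binary.PropositionalEquality.Properties using (module ≡-Reasoning)
open import Relation.Nullary using (¬_; ¬?)
open import Relation.Nullary.Decidable using (T?)

open import Defs

open Equivalence using (to; from)

T-injective : ∀ {x y} → (T x → T y) → (T y → T x) → x ≡ y
T-injective {true}  {true}  _   _   = refl
T-injective {true}  {false} x⇒y _   = ⊥-elim (x⇒y _)
T-injective {false} {true}  _   y⇒x = ⊥-elim (y⇒x _)
T-injective {false} {false} _   _   = refl

++-elim : ∀ {A : Set} {m n} {P : Vec A (m + n) → Set} → (∀ u v → P (u ++ v)) → ∀ w → P w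
++-elim {m = m} f w with splitAt m w
... | u , v , refl = f u v

↑ˡ≢↑ʳ : ∀ {m n} (i : Fin m) (j : Fin n) → i ↑ˡ n ≢ m ↑ʳ j
↑ˡ≢↑ʳ zero    j ()
↑ˡ≢↑ʳ (suc i) j i↑≡↑j = ↑ˡ≢↑ʳ i j (suc-injective i↑≡↑j)

select : ∀ {A : Set} {m n} → Vec A m → Vec (Fin m) n → Vec A n
select β σ = vmap (vlookup β) σ

module _ {A : Set} {m n k : ℕ} (u : Vec A m) (v : Vec A n) where

  select-↑ˡ : (σ : Vec (Fin m) k) → select (u ++ v) (vmap (_↑ˡ n) σ) ≡ select u σ
  select-↑ˡ σ = trans (sym (map-∘ _ _ σ)) (map-cong (lookup-++ˡ u v) σ)

  select-↑ʳ : (σ : Vec (Fin n) k) → select (u ++ v) (vmap (m ↑ʳ_) σ) ≡ select v σ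
  select-↑ʳ σ = trans (sym (map-∘ _ _ σ)) (map-cong (lookup-++ʳ u v) σ)

-- Mixing vectors along a mask

mix : ∀ {A : Set} {m} → (Fin m → Bool) → Vec A m → Vec A m → Vec A m
mix V []      []      = []
mix V (x ∷ u) (y ∷ v) = (if V zero then x else y) ∷ mix (V ∘ suc) u v

module _ {A : Set} where

  lookup-mix : ∀ {m} (V : Fin m → Bool) (u v : Vec A m) i →
               vlookup (mix V u v) i ≡ (if V i then vlookup u i else vlookup v i)
  lookup-mix V (x ∷ u) (y ∷ v) zero    = refl
  lookup-mix V (x ∷ u) (y ∷ v) (suc i) = lookup-mix (V ∘ suc) u v i

  mix-++ : ∀ {m n} (V : Fin (m + n) → Bool) (u u' : Vec A m) (v v' : Vec A n) →
           mix V (u ++ v) (u' ++ v') ≡ mix (V ∘ (_↑ˡ n)) u u' ++ mix (V ∘ (m ↑ʳ_)) v v'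
  mix-++ V []      []       v v' = refl
  mix-++ V (x ∷ u) (y ∷ u') v v' = cong (_ ∷_) (mix-++ (V ∘ suc) u u' v v')

  mix-idem : ∀ {m} (V : Fin m → Bool) (u : Vec A m) → mix V u u ≡ u
  mix-idem V []      = refl
  mix-idem V (x ∷ u) with V zero
  ... | true  = cong (x ∷_) (mix-idem (V ∘ suc) u)
  ... | false = cong (x ∷_) (mix-idem (V ∘ suc) u)

  mix-true : ∀ {m} (V : Fin m → Bool) (u v : Vec A m) → (∀ i → V i ≡ true) → mix V u v ≡ u
  mix-true V []      []      _ = refl
  mix-true V (x ∷ u) (y ∷ v) V≡true rewrite V≡true zero =
    cong (x ∷_) (mix-true (V ∘ suc) u v (V≡true ∘ suc))

  mix-false : ∀ {m} (V : Fin m → Bool) (u v : Vec A m) → (∀ i → V i ≡ false) → mix V u v ≡ v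
  mix-false V []      []      _ = refl
  mix-false V (x ∷ u) (y ∷ v) V≡false rewrite V≡false zero =
    cong (y ∷_) (mix-false (V ∘ suc) u v (V≡false ∘ suc))

  mix-∧ : ∀ {m} (V W : Fin m → Bool) (u v : Vec A m) →
          mix (λ i → V i ∧ W i) u v ≡ mix V (mix W u v) v
  mix-∧ V W []      []      = refl
  mix-∧ V W (x ∷ u) (y ∷ v) with V zero | W zero
  ... | true  | true  = cong (x ∷_) (mix-∧ (V ∘ suc) (W ∘ suc) u v)
  ... | true  | false = cong (y ∷_) (mix-∧ (V ∘ suc) (W ∘ suc) u v)
  ... | false | _     = cong (y ∷_) (mix-∧ (V ∘ suc) (W ∘ suc) u v)

  mix-∨ : ∀ {m} (V W : Fin m → Bool) (u v : Vec A m) →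
          mix (λ i → V i ∨ W i) u v ≡ mix V u (mix W u v)
  mix-∨ V W []      []      = refl
  mix-∨ V W (x ∷ u) (y ∷ v) with V zero | W zero
  ... | true  | _     = cong (x ∷_) (mix-∨ (V ∘ suc) (W ∘ suc) u v)
  ... | false | true  = cong (x ∷_) (mix-∨ (V ∘ suc) (W ∘ suc) u v)
  ... | false | false = cong (y ∷_) (mix-∨ (V ∘ suc) (W ∘ suc) u v)

  mix-mix : ∀ {m} (V : Fin m → Bool) (u v : Vec A m) → mix V (mix V u v) (mix V v u) ≡ u
  mix-mix V []      []      = refl
  mix-mix V (x ∷ u) (y ∷ v) with V zero
  ... | true  = cong (x ∷_) (mix-mix (V ∘ suc) u v)
  ... | false = cong (x ∷_) (mix-mix (V ∘ suc) u v)

MixClosed : ∀ {A : Set} {m} → (Vec A m → Set) → (Fin m → Bool) → Set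
MixClosed P V = ∀ u v → P u → P v → P (mix V u v)

module _ {A : Set} {m : ℕ} {P : Vec A m → Set} where

  mixClosed-∧ : ∀ {V W} → MixClosed P V → MixClosed P W → MixClosed P (λ i → V i ∧ W i)
  mixClosed-∧ {V} {W} closedV closedW u v Pu Pv =
    subst P (sym (mix-∧ V W u v)) (closedV _ v (closedW u v Pu Pv) Pv)

  mixClosed-∨ : ∀ {V W} → MixClosed P V → MixClosed P W → MixClosed P (λ i → V i ∨ W i)
  mixClosed-∨ {V} {W} closedV closedW u v Pu Pv =
    subst P (sym (mix-∨ V W u v)) (closedV u _ Pu (closedW u v Pu Pv))

  mixClosed-true : MixClosed P (λ _ → true)
  mixClosed-true u v Pu Pv = subst P (sym (mix-true _ u v (λ _ → refl))) Pu

  mixClosed-false : MixClosed P (λ _ → false)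
  mixClosed-false u v Pu Pv = subst P (sym (mix-false _ u v (λ _ → refl))) Pv

  Separating : ∀ {k l} → (Fin k → Fin m) → (Fin l → Fin m) → (Fin m → Bool) → Set
  Separating f g V = (∀ i → V (f i) ≡ true) × (∀ j → V (g j) ≡ false) × MixClosed P V

  separating-one : ∀ {l} x (g : Fin l → Fin m) →
                   (∀ j → ∃ λ V → V x ≡ true × V (g j) ≡ false × MixClosed P V) →
                   ∃ (Separating (λ (_ : Fin 1) → x) g)
  separating-one {0}       x g _ = (λ _ → true) , (λ _ → refl) , (λ ()) , mixClosed-true
  separating-one {ℕ.suc l} x g sep
    with sep zero | separating-one x (g ∘ suc) (sep ∘ suc)
  ... | V , Vx , Vg₀ , closedV | W , Wx , Wg , closedW =
    (λ i → V i ∧ W i) , (λ _ → cong₂ _∧_ Vx (Wx zero)) , V∧W-false , mixClosed-∧ closedV closedW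
    where
    V∧W-false : ∀ j → V (g j) ∧ W (g j) ≡ false
    V∧W-false zero    rewrite Vg₀ = refl
    V∧W-false (suc j) = trans (cong (V (g (suc j)) ∧_) (Wg j)) (∧-zeroʳ _)

  separating-pairwise : ∀ {k l} (f : Fin k → Fin m) (g : Fin l → Fin m) →
                        (∀ i j → ∃ λ V → V (f i) ≡ true × V (g j) ≡ false × MixClosed P V) →
                        ∃ (Separating f g)
  separating-pairwise {0}       f g _ = (λ _ → false) , (λ ()) , (λ _ → refl) , mixClosed-false
  separating-pairwise {ℕ.suc k} f g sep
    with separating-one (f zero) g (sep zero) | separating-pairwise (f ∘ suc) g (sep ∘ suc)
  ... | V , Vf₀ , Vg , closedV | W , Wf , Wg , closedW =
    (λ i → V i ∨ W i) , V∨W-true , (λ j → cong₂ _∨_ (Vg j) (Wg j)) , mixClosed-∨ closedV closedW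
    where
    V∨W-true : ∀ i → V (f i) ∨ W (f i) ≡ true
    V∨W-true zero    rewrite Vf₀ zero = refl
    V∨W-true (suc i) = trans (cong (V (f (suc i)) ∨_) (Wf i)) (∨-zeroʳ _)

decomposable⇒mixClosed : ∀ {d n} {S : Vec (Fin d) n → Set} {V} → Decomposable S V → MixClosed S V
decomposable⇒mixClosed {V = V} decomp u v Su Sv =
  proj₂ (decomp (mix V u v)) (u , v , Su , Sv , agree , agree)
  where
  agree : ∀ {b} i → V i ≡ b → vlookup (mix V u v) i ≡ (if b then vlookup u i else vlookup v i)
  agree i refl = lookup-mix V u v i

-- Proper block matrices

module _ {Rw Cl : Set} {nz : Rw → Cl → Set} (P : ProperBlock Rw Cl nz) where
  open ProperBlock P

  row∈block : ∀ {a b} ℓ → nz a b → T (B ℓ b) → T (A ℓ a)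
  row∈block ℓ nzab Bℓb with blocks⇒ _ _ nzab
  ... | ℓ' , Aℓ'a , Bℓ'b = subst (λ ℓ → T (A ℓ _)) (B-disj ℓ' ℓ _ Bℓ'b Bℓb) Aℓ'a

  col∈block : ∀ {a b} ℓ → nz a b → T (A ℓ a) → T (B ℓ b)
  col∈block ℓ nzab Aℓa with blocks⇒ _ _ nzab
  ... | ℓ' , Aℓ'a , Bℓ'b = subst (λ ℓ → T (B ℓ _)) (A-disj ℓ' ℓ _ Aℓ'a Aℓa) Bℓ'b

properBlock-resp-⇔ : ∀ {Rw Cl : Set} {nz nz' : Rw → Cl → Set} →
                     (∀ a b → nz a b ⇔ nz' a b) → ProperBlock Rw Cl nz → ProperBlock Rw Cl nz'
properBlock-resp-⇔ nz⇔nz' P = record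
  { k = k ; A = A ; B = B ; A-disj = A-disj ; B-disj = B-disj ; A-ne = A-ne ; B-ne = B-ne
  ; blocks⇒ = λ a b → blocks⇒ a b ∘ from (nz⇔nz' a b)
  ; blocks⇐ = λ a b ℓ Aℓa Bℓb → to (nz⇔nz' a b) (blocks⇐ a b ℓ Aℓa Bℓb)
  }
  where open ProperBlock P

deduplicate-apart : ∀ {A : Set} {R : A → A → Set} (R? : Decidable R) xs →
                    AllPairs (λ u v → ¬ R u v) (deduplicate R? xs)
deduplicate-apart R? []       = []
deduplicate-apart R? (x ∷ xs) =
  All.all-filter (¬? ∘ R? x) (deduplicate R? xs) ∷ AllPairs.filter⁺ (¬? ∘ R? x) (deduplicate-apart R? xs)

apart-lookup-injective : ∀ {A : Set} {R : A → A → Set} → Symmetric R → ∀ {xs} →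
                         AllPairs (λ u v → ¬ R u v) xs → ∀ i j → R (lookup xs i) (lookup xs j) → i ≡ j
apart-lookup-injective sym (_ ∷ _)     zero    zero    _ = refl
apart-lookup-injective sym (x≁ ∷ _)    zero    (suc j) r = ⊥-elim (All.lookup x≁ (∈-lookup j) r)
apart-lookup-injective sym (x≁ ∷ _)    (suc i) zero    r = ⊥-elim (All.lookup x≁ (∈-lookup i) (sym r))
apart-lookup-injective sym (_ ∷ apart) (suc i) (suc j) r = cong suc (apart-lookup-injective sym apart i j r)

Rectangular : ∀ {Rw Cl : Set} → (Rw → Cl → Bool) → Set
Rectangular S = ∀ a a' b b' → T (S a b) → T (S a' b) → T (S a b') → T (S a' b')

module RectangularBlocks {Rw Cl : Set} (S : Rw → Cl → Bool) (rect : Rectangular S)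
  (rows : List Rw) (∈-rows : ∀ a → a ∈ rows) (cols : List Cl) (∈-cols : ∀ b → b ∈ cols) where

  linked : Rw → Rw → Bool
  linked a a' = any (λ b → S a b ∧ S a' b) cols

  Linked : Rw → Rw → Set
  Linked a a' = T (linked a a')

  linked⁺ : ∀ {a a' b} → T (S a b) → T (S a' b) → Linked a a'
  linked⁺ Sab Sa'b = any⁺ _ (lose (∈-cols _) (from T-∧ (Sab , Sa'b)))

  linked⁻ : ∀ {a a'} → Linked a a' → ∃ λ b → T (S a b) × T (S a' b)
  linked⁻ a~a' with satisfied (any⁻ _ cols a~a')
  ... | b , Sab∧Sa'b = b , to T-∧ Sab∧Sa'b

  linked-sym : Symmetric Linked
  linked-sym a~a' with linked⁻ a~a'
  ... | b , Sab , Sa'b = linked⁺ Sa'b Sab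

  linked-S : ∀ {a a' b} → Linked a a' → T (S a' b) → T (S a b)
  linked-S a~a' Sa'b with linked⁻ a~a'
  ... | b' , Sab' , Sa'b' = rect _ _ b' _ Sa'b' Sab' Sa'b

  linked-trans : ∀ {a a' a''} → Linked a a' → Linked a' a'' → Linked a a''
  linked-trans a~a' a'~a'' with linked⁻ a'~a''
  ... | b , Sa'b , Sa''b = linked⁺ (linked-S a~a' Sa'b) Sa''b

  inhabited-rows : List Rw
  inhabited-rows = filterᵇ (λ a → linked a a) rows

  representatives : List Rw
  representatives = deduplicateᵇ linked inhabited-rows

  representatives-inhabited : All (λ u → Linked u u) representatives
  representatives-inhabited = All.deduplicate⁺ _ (All.all-filter (T? ∘ (λ a → linked a a)) rows)

  representative : ∀ {a} → Linked a a → Any (Linked a) representatives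
  representative a~a = Any.deduplicate⁺ _ (λ u'~u a~u → linked-trans a~u (linked-sym u'~u))
    (lose (∈-filter⁺ (T? ∘ (λ a → linked a a)) (∈-rows _) a~a) a~a)

  rep : Fin (length representatives) → Rw
  rep = lookup representatives

  rep-inhabited : ∀ ℓ → Linked (rep ℓ) (rep ℓ)
  rep-inhabited ℓ = All.lookup representatives-inhabited (∈-lookup ℓ)

  rep-injective : ∀ ℓ ℓ' → Linked (rep ℓ) (rep ℓ') → ℓ ≡ ℓ'
  rep-injective = apart-lookup-injective linked-sym
    (deduplicate-apart (λ a a' → T? (linked a a')) inhabited-rows)

  rep-linked : ∀ a b → T (S a b) → ∃ λ ℓ → Linked a (rep ℓ) × T (S (rep ℓ) b)
  rep-linked a b Sab = index a~rep , a~ℓ , linked-S (linked-sym a~ℓ) Sab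
    where
    a~rep : Any (Linked a) representatives
    a~rep = representative (linked⁺ Sab Sab)
    a~ℓ : Linked a (rep (index a~rep))
    a~ℓ = lookup-index a~rep

  properBlock : ProperBlock Rw Cl (λ a b → T (S a b))
  properBlock = record
    { k       = length representatives
    ; A       = λ ℓ a → linked a (rep ℓ)
    ; B       = λ ℓ b → S (rep ℓ) b
    ; A-disj  = λ ℓ ℓ' a a~ℓ a~ℓ' → rep-injective ℓ ℓ' (linked-trans (linked-sym a~ℓ) a~ℓ')
    ; B-disj  = λ ℓ ℓ' b Sℓb Sℓ'b → rep-injective ℓ ℓ' (linked⁺ Sℓb Sℓ'b)
    ; A-ne    = λ ℓ → rep ℓ , rep-inhabited ℓ
    ; B-ne    = λ ℓ → let b , Sℓb , _ = linked⁻ (rep-inhabited ℓ) in b , Sℓb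
    ; blocks⇒ = rep-linked
    ; blocks⇐ = λ a b ℓ a~ℓ Sℓb → linked-S a~ℓ Sℓb
    }

-- Sums and counts over D^m

∈-allVec : ∀ {d m} (w : Vec (Fin d) m) → w ∈ allVec d m
∈-allVec               []      = here refl
∈-allVec {d} {ℕ.suc m} (x ∷ w) =
  ∈-concatMap⁺ (λ x → map (x ∷_) (allVec d m)) (lose (∈-allFin x) (∈-map⁺ (x ∷_) (∈-allVec w)))

any-allVec⇔ : ∀ {d m} (P : Vec (Fin d) m → Bool) → T (any P (allVec d m)) ⇔ ∃ (T ∘ P)
any-allVec⇔ {d} {m} P =
  mk⇔ (satisfied ∘ any⁻ P (allVec d m)) (λ (w , Pw) → any⁺ P (lose (∈-allVec w) Pw))

∑ : ∀ {A : Set} → List A → (A → ℕ) → ℕ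
∑ xs f = sum (map f xs)

module _ {A : Set} where

  ∑-cong : ∀ (xs : List A) {f g} → (∀ x → f x ≡ g x) → ∑ xs f ≡ ∑ xs g
  ∑-cong []       f≡g = refl
  ∑-cong (x ∷ xs) f≡g = cong₂ _+_ (f≡g x) (∑-cong xs f≡g)

  ∑-++ : ∀ (xs ys : List A) f → ∑ (xs ++ₗ ys) f ≡ ∑ xs f + ∑ ys f
  ∑-++ []       ys f = refl
  ∑-++ (x ∷ xs) ys f = trans (cong (f x +_) (∑-++ xs ys f)) (sym (+-assoc (f x) _ _))

  ∑-+ : ∀ (xs : List A) f g → ∑ xs (λ x → f x + g x) ≡ ∑ xs f + ∑ xs g
  ∑-+ []       f g = refl
  ∑-+ (x ∷ xs) f g = trans (cong (f x + g x +_) (∑-+ xs f g)) (interchange (f x) (g x) _ _)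

  *-∑ : ∀ k (xs : List A) f → k * ∑ xs f ≡ ∑ xs (λ x → k * f x)
  *-∑ k []       f = *-zeroʳ k
  *-∑ k (x ∷ xs) f = trans (*-distribˡ-+ k (f x) _) (cong (k * f x +_) (*-∑ k xs f))

  ∑-* : ∀ k (xs : List A) f → ∑ xs f * k ≡ ∑ xs (λ x → f x * k)
  ∑-* k []       f = refl
  ∑-* k (x ∷ xs) f = trans (*-distribʳ-+ k (f x) _) (cong (f x * k +_) (∑-* k xs f))

module _ {A B : Set} where

  ∑-map : ∀ (xs : List A) (h : A → B) f → ∑ (map h xs) f ≡ ∑ xs (f ∘ h)
  ∑-map []       h f = refl
  ∑-map (x ∷ xs) h f = cong (f (h x) +_) (∑-map xs h f)

  ∑-concatMap : ∀ (xs : List A) (g : A → List B) f → ∑ (concatMap g xs) f ≡ ∑ xs (λ x → ∑ (g x) f)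
  ∑-concatMap []       g f = refl
  ∑-concatMap (x ∷ xs) g f =
    trans (∑-++ (g x) (concatMap g xs) f) (cong (∑ (g x) f +_) (∑-concatMap xs g f))

  ∑-comm : ∀ (xs : List A) (ys : List B) (f : A → B → ℕ) →
           ∑ xs (λ x → ∑ ys (f x)) ≡ ∑ ys (λ y → ∑ xs (λ x → f x y))
  ∑-comm []       ys f = sym (∑-zero ys)
    where
    ∑-zero : ∀ (ys : List B) → ∑ ys (λ _ → 0) ≡ 0
    ∑-zero []       = refl
    ∑-zero (y ∷ ys) = ∑-zero ys
  ∑-comm (x ∷ xs) ys f =
    trans (cong (∑ ys (f x) +_) (∑-comm xs ys f)) (sym (∑-+ ys (f x) (λ y → ∑ xs (λ x' → f x' y))))

ind : Bool → ℕ
ind b = if b then 1 else 0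

ind-∧ : ∀ x y → ind x * ind y ≡ ind (x ∧ y)
ind-∧ true  y = +-identityʳ (ind y)
ind-∧ false y = refl

any⇔∑-ind≢0 : ∀ {A : Set} (P : A → Bool) xs → T (any P xs) ⇔ (∑ xs (ind ∘ P) ≢ 0)
any⇔∑-ind≢0 P xs = mk⇔ (any⇒≢0 xs) (≢0⇒any xs)
  where
  ≢0⇒any : ∀ xs → ∑ xs (ind ∘ P) ≢ 0 → T (any P xs)
  ≢0⇒any []       ≢0 = ≢0 refl
  ≢0⇒any (x ∷ xs) ≢0 with P x
  ... | true  = _
  ... | false = ≢0⇒any xs ≢0
  any⇒≢0 : ∀ xs → T (any P xs) → ∑ xs (ind ∘ P) ≢ 0
  any⇒≢0 (x ∷ xs) anyP with P x
  ... | true  = λ ()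
  ... | false = any⇒≢0 xs anyP

module _ {d : ℕ} where
  open ≡-Reasoning

  ∑-allVec-suc : ∀ m (f : Vec (Fin d) (ℕ.suc m) → ℕ) →
                 ∑ (allVec d (ℕ.suc m)) f ≡ ∑ (allFin d) (λ x → ∑ (allVec d m) (f ∘ (x ∷_)))
  ∑-allVec-suc m f =
    trans (∑-concatMap (allFin d) _ f) (∑-cong (allFin d) (λ x → ∑-map (allVec d m) (x ∷_) f))

  ∑∑ : ∀ m → (Vec (Fin d) m → Vec (Fin d) m → ℕ) → ℕ
  ∑∑ m F = ∑ (allVec d m) (λ c → ∑ (allVec d m) (F c))

  ∑∑-suc : ∀ m F → ∑∑ (ℕ.suc m) F ≡
           ∑ (allFin d) (λ x → ∑ (allFin d) (λ x' → ∑∑ m (λ c c' → F (x ∷ c) (x' ∷ c'))))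
  ∑∑-suc m F = begin
    ∑∑ (ℕ.suc m) F
      ≡⟨ ∑-allVec-suc m _ ⟩
    ∑ (allFin d) (λ x → ∑ (allVec d m) (λ c → ∑ (allVec d (ℕ.suc m)) (F (x ∷ c))))
      ≡⟨ ∑-cong (allFin d) (λ x → ∑-cong (allVec d m) (λ c → ∑-allVec-suc m (F (x ∷ c)))) ⟩
    ∑ (allFin d) (λ x → ∑ (allVec d m) (λ c →
      ∑ (allFin d) (λ x' → ∑ (allVec d m) (F (x ∷ c) ∘ (x' ∷_)))))
      ≡⟨ ∑-cong (allFin d) (λ x → ∑-comm (allVec d m) (allFin d) _) ⟩
    ∑ (allFin d) (λ x → ∑ (allFin d) (λ x' → ∑∑ m (λ c c' → F (x ∷ c) (x' ∷ c')))) ∎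

  ∑∑-mix : ∀ m (V : Fin m → Bool) F → ∑∑ m F ≡ ∑∑ m (λ c c' → F (mix V c c') (mix V c' c))
  ∑∑-mix 0         V F = refl
  ∑∑-mix (ℕ.suc m) V F = begin
    ∑∑ (ℕ.suc m) F
      ≡⟨ ∑∑-suc m F ⟩
    ∑ (allFin d) (λ x → ∑ (allFin d) (λ x' → ∑∑ m (λ c c' → F (x ∷ c) (x' ∷ c'))))
      ≡⟨ ∑-cong (allFin d) (λ x → ∑-cong (allFin d) (λ x' → ∑∑-mix m (V ∘ suc) _)) ⟩
    ∑ (allFin d) (λ x → ∑ (allFin d) (λ x' →
      ∑∑ m (λ c c' → F (x ∷ mix (V ∘ suc) c c') (x' ∷ mix (V ∘ suc) c' c))))
      ≡⟨ swap-heads (V zero) ⟩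
    ∑ (allFin d) (λ x → ∑ (allFin d) (λ x' →
      ∑∑ m (λ c c' → F (mix V (x ∷ c) (x' ∷ c')) (mix V (x' ∷ c') (x ∷ c)))))
      ≡⟨ ∑∑-suc m _ ⟨
    ∑∑ (ℕ.suc m) (λ c c' → F (mix V c c') (mix V c' c)) ∎
    where
    swap-heads : ∀ v →
      ∑ (allFin d) (λ x → ∑ (allFin d) (λ x' →
        ∑∑ m (λ c c' → F (x ∷ mix (V ∘ suc) c c') (x' ∷ mix (V ∘ suc) c' c)))) ≡
      ∑ (allFin d) (λ x → ∑ (allFin d) (λ x' →
        ∑∑ m (λ c c' → F ((if v then x else x') ∷ mix (V ∘ suc) c c')
                         ((if v then x' else x) ∷ mix (V ∘ suc) c' c))))
    swap-heads true  = refl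
    swap-heads false = ∑-comm (allFin d) (allFin d) _

  count-* : ∀ {m} (P Q : Vec (Fin d) m → Bool) → count P * count Q ≡ ∑∑ m (λ c c' → ind (P c ∧ Q c'))
  count-* {m} P Q = begin
    count P * count Q
      ≡⟨ ∑-* (count Q) (allVec d m) (ind ∘ P) ⟩
    ∑ (allVec d m) (λ c → ind (P c) * count Q)
      ≡⟨ ∑-cong (allVec d m) (λ c → *-∑ (ind (P c)) (allVec d m) (ind ∘ Q)) ⟩
    ∑∑ m (λ c c' → ind (P c) * ind (Q c'))
      ≡⟨ ∑-cong (allVec d m) (λ c → ∑-cong (allVec d m) (λ c' → ind-∧ (P c) (Q c'))) ⟩
    ∑∑ m (λ c c' → ind (P c ∧ Q c')) ∎

-- Primitive-positive formulas

module _ {A : Set} where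

  all-++ : ∀ (f : A → Bool) xs ys → all f (xs ++ₗ ys) ≡ all f xs ∧ all f ys
  all-++ f []       ys = refl
  all-++ f (x ∷ xs) ys = trans (cong (f x ∧_) (all-++ f xs ys)) (sym (∧-assoc (f x) _ _))

module _ {A B : Set} where

  all-map : ∀ (f : B → Bool) (g : A → B) {h} → (∀ x → f (g x) ≡ h x) →
            ∀ xs → all f (map g xs) ≡ all h xs
  all-map f g fg≡h []       = refl
  all-map f g fg≡h (x ∷ xs) = cong₂ _∧_ (fg≡h x) (all-map f g fg≡h xs)

module _ {d : ℕ} {Γ : Language d} where

  rename : ∀ {v v'} → Vec (Fin v') v → Atom Γ v → Atom Γ v'
  rename σ (rel i xs) = rel i (select σ xs)
  rename σ (eq i j)   = eq (vlookup σ i) (vlookup σ j)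

  evalAtom-rename : ∀ {v v'} (σ : Vec (Fin v') v) (β : Vec (Fin d) v') a →
                    evalAtom β (rename σ a) ≡ evalAtom (select β σ) a
  evalAtom-rename σ β (rel i xs) = cong (proj₂ (lookup Γ i))
    (trans (sym (map-∘ _ _ xs)) (map-cong (λ j → sym (lookup-map j (vlookup β) σ)) xs))
  evalAtom-rename σ β (eq i j) rewrite lookup-map i (vlookup β) σ | lookup-map j (vlookup β) σ = refl

module _ {m n : ℕ} (e : ℕ) where

  copy₁ copy₂ : Vec (Fin n) m → Vec (Fin (n + (e + e))) (m + e)
  copy₁ σ = vmap (_↑ˡ (e + e)) σ ++ vmap (n ↑ʳ_) (vmap (_↑ˡ e) (Vec.allFin e))
  copy₂ σ = vmap (_↑ˡ (e + e)) σ ++ vmap (n ↑ʳ_) (vmap (e ↑ʳ_) (Vec.allFin e))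

  module _ {A : Set} (σ : Vec (Fin n) m) (β : Vec A n) (w₁ w₂ : Vec A e) where
    open ≡-Reasoning

    select-copy₁ : select (β ++ (w₁ ++ w₂)) (copy₁ σ) ≡ select β σ ++ w₁
    select-copy₁ = trans (map-++ _ (vmap (_↑ˡ (e + e)) σ) _) (cong₂ _++_ (select-↑ˡ β _ σ) (begin
      select (β ++ (w₁ ++ w₂)) (vmap (n ↑ʳ_) (vmap (_↑ˡ e) (Vec.allFin e))) ≡⟨ select-↑ʳ β _ _ ⟩
      select (w₁ ++ w₂) (vmap (_↑ˡ e) (Vec.allFin e))                      ≡⟨ select-↑ˡ w₁ w₂ _ ⟩
      select w₁ (Vec.allFin e)                                              ≡⟨ map-lookup-allFin w₁ ⟩
      w₁                                                                    ∎))

    select-copy₂ : select (β ++ (w₁ ++ w₂)) (copy₂ σ) ≡ select β σ ++ w₂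
    select-copy₂ = trans (map-++ _ (vmap (_↑ˡ (e + e)) σ) _) (cong₂ _++_ (select-↑ˡ β _ σ) (begin
      select (β ++ (w₁ ++ w₂)) (vmap (n ↑ʳ_) (vmap (e ↑ʳ_) (Vec.allFin e))) ≡⟨ select-↑ʳ β _ _ ⟩
      select (w₁ ++ w₂) (vmap (e ↑ʳ_) (Vec.allFin e))                      ≡⟨ select-↑ʳ w₁ w₂ _ ⟩
      select w₂ (Vec.allFin e)                                              ≡⟨ map-lookup-allFin w₂ ⟩
      w₂                                                                    ∎))

module _ {d : ℕ} {Γ : Language d} {m n : ℕ} where

  twoCopies : PP Γ m → (σ₁ σ₂ : Vec (Fin n) m) → PP Γ n
  twoCopies (pp e as) σ₁ σ₂ =
    pp (e + e) (map (rename (copy₁ e σ₁)) as ++ₗ map (rename (copy₂ e σ₂)) as)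

  sat-twoCopies : ∀ (φ : PP Γ m) σ₁ σ₂ β →
                  T (sat (twoCopies φ σ₁ σ₂) β) ⇔
                  (T (sat φ (select β σ₁)) × T (sat φ (select β σ₂)))
  sat-twoCopies φ@(pp e as) σ₁ σ₂ β = mk⇔ split join
    where
    holds : Vec (Fin d) (m + e) → Bool
    holds γ = all (evalAtom γ) as

    holds-copies : ∀ w₁ w₂ → all (evalAtom (β ++ (w₁ ++ w₂))) (PP.atoms (twoCopies φ σ₁ σ₂))
                             ≡ holds (select β σ₁ ++ w₁) ∧ holds (select β σ₂ ++ w₂)
    holds-copies w₁ w₂ = trans (all-++ _ (map (rename (copy₁ e σ₁)) as) _) (cong₂ _∧_
      (all-map _ _ (renamed (select-copy₁ e σ₁ β w₁ w₂)) as)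
      (all-map _ _ (renamed (select-copy₂ e σ₂ β w₁ w₂)) as))
      where
      renamed : ∀ {ρ γ} → select (β ++ (w₁ ++ w₂)) ρ ≡ γ →
                ∀ a → evalAtom (β ++ (w₁ ++ w₂)) (rename ρ a) ≡ evalAtom γ a
      renamed {ρ} refl a = evalAtom-rename ρ _ a

    split : T (sat (twoCopies φ σ₁ σ₂) β) → T (sat φ (select β σ₁)) × T (sat φ (select β σ₂))
    split s with to (any-allVec⇔ _) s
    ... | w , holds-w with splitAt e w
    ... | w₁ , w₂ , refl with to T-∧ (subst T (holds-copies w₁ w₂) holds-w)
    ... | holds₁ , holds₂ = from (any-allVec⇔ _) (w₁ , holds₁) , from (any-allVec⇔ _) (w₂ , holds₂)

    join : T (sat φ (select β σ₁)) × T (sat φ (select β σ₂)) → T (sat (twoCopies φ σ₁ σ₂) β)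
    join (s₁ , s₂) with to (any-allVec⇔ _) s₁ | to (any-allVec⇔ _) s₂
    ... | w₁ , holds₁ | w₂ , holds₂ =
      from (any-allVec⇔ _) (w₁ ++ w₂ , subst T (sym (holds-copies w₁ w₂)) (from T-∧ (holds₁ , holds₂)))

-- Strong balance

module _ {d : ℕ} {Γ : Language d} (p q r : ℕ) (φ : PP Γ (p + q + r)) where

  private
    n = p + q + r

  R : Vec (Fin d) n → Bool
  R = sat φ

  N : Vec (Fin d) p → Vec (Fin d) q → ℕ
  N = CountMatrix p q r R

  support : Vec (Fin d) p → Vec (Fin d) q → Bool
  support a b = any (λ c → R ((a ++ b) ++ c)) (allVec d r)

  xIdx : Fin p → Fin n
  xIdx i = (i ↑ˡ q) ↑ˡ r

  yIdx : Fin q → Fin n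
  yIdx j = (p ↑ʳ j) ↑ˡ r

  -- The variables of pair are (x, y, z, y', z'); σ₁ picks (x, y, z) and σ₂ picks (x, y', z').
  σ₁ σ₂ : Vec (Fin (n + (q + r))) n
  σ₁ = vmap (_↑ˡ (q + r)) (Vec.allFin n)
  σ₂ = (σ₂-x ++ σ₂-y') ++ σ₂-z'
    module σ₂ where
    σ₂-x : Vec (Fin (n + (q + r))) p
    σ₂-x = vmap (_↑ˡ (q + r)) (vmap (_↑ˡ r) (vmap (_↑ˡ q) (Vec.allFin p)))
    σ₂-y' : Vec (Fin (n + (q + r))) q
    σ₂-y' = vmap (n ↑ʳ_) (vmap (_↑ˡ r) (Vec.allFin q))
    σ₂-z' : Vec (Fin (n + (q + r))) r
    σ₂-z' = vmap (n ↑ʳ_) (vmap (q ↑ʳ_) (Vec.allFin r))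

  pair : PP Γ (n + (q + r))
  pair = twoCopies φ σ₁ σ₂

  sat-pair : ∀ a b c b' c' →
             T (sat pair (((a ++ b) ++ c) ++ (b' ++ c'))) ⇔ (T (R ((a ++ b) ++ c)) × T (R ((a ++ b') ++ c')))
  sat-pair a b c b' c' =
    subst₂ (λ β β' → T (sat pair γ) ⇔ (T (R β) × T (R β'))) select-σ₁ select-σ₂
           (sat-twoCopies φ σ₁ σ₂ γ)
    where
    γ : Vec (Fin d) (n + (q + r))
    γ = ((a ++ b) ++ c) ++ (b' ++ c')
    open σ₂
    open ≡-Reasoning

    select-σ₁ : select γ σ₁ ≡ (a ++ b) ++ c
    select-σ₁ = trans (select-↑ˡ ((a ++ b) ++ c) (b' ++ c') _) (map-lookup-allFin _)

    select-σ₂ : select γ σ₂ ≡ (a ++ b') ++ c'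
    select-σ₂ = begin
      select γ σ₂
        ≡⟨ map-++ (vlookup γ) (σ₂-x ++ σ₂-y') σ₂-z' ⟩
      select γ (σ₂-x ++ σ₂-y') ++ select γ σ₂-z'
        ≡⟨ cong (_++ select γ σ₂-z') (map-++ (vlookup γ) σ₂-x σ₂-y') ⟩
      (select γ σ₂-x ++ select γ σ₂-y') ++ select γ σ₂-z'
        ≡⟨ cong₂ _++_ (cong₂ _++_ select-x select-y') select-z' ⟩
      (a ++ b') ++ c' ∎
      where
      select-x : select γ σ₂-x ≡ a
      select-x = trans (select-↑ˡ ((a ++ b) ++ c) _ _)
                 (trans (select-↑ˡ (a ++ b) c _) (trans (select-↑ˡ a b _) (map-lookup-allFin a)))
      select-y' : select γ σ₂-y' ≡ b'
      select-y' = trans (select-↑ʳ ((a ++ b) ++ c) _ _) (trans (select-↑ˡ b' c' _) (map-lookup-allFin b'))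
      select-z' : select γ σ₂-z' ≡ c'
      select-z' = trans (select-↑ʳ ((a ++ b) ++ c) _ _) (trans (select-↑ʳ b' c' _) (map-lookup-allFin c'))

  -- Solutions of R whose (x, b) lies in the support; the second conjunct of pair, with y' = b,
  -- is what keeps this side condition invariant under mixing.
  Fibre : Vec (Fin d) q → Vec (Fin d) n → Set
  Fibre b β = ∃ λ c' → T (sat pair (β ++ (b ++ c')))

  fibre⁺ : ∀ {a b} b₁ c → T (support a b) → T (R ((a ++ b₁) ++ c)) → Fibre b ((a ++ b₁) ++ c)
  fibre⁺ {a} {b} b₁ c sab R₁ with to (any-allVec⇔ _) sab
  ... | c' , R₂ = c' , from (sat-pair a b₁ c b c') (R₁ , R₂)

  fibre⁻ : ∀ {b} a b₁ c → Fibre b ((a ++ b₁) ++ c) → T (R ((a ++ b₁) ++ c))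
  fibre⁻ {b} a b₁ c (c' , s) = proj₁ (to (sat-pair a b₁ c b c') s)

  xPos : Fin p → Fin (n + (q + r))
  xPos i = xIdx i ↑ˡ (q + r)

  yPos : Fin q → Fin (n + (q + r))
  yPos j = yIdx j ↑ˡ (q + r)

  xPos≢yPos : ∀ i j → xPos i ≢ yPos j
  xPos≢yPos i j = ↑ˡ≢↑ʳ i j ∘ ↑ˡ-injective r _ _ ∘ ↑ˡ-injective (q + r) _ _

  lookup-xPos : ∀ a b c (γ : Vec (Fin d) (q + r)) i → vlookup (((a ++ b) ++ c) ++ γ) (xPos i) ≡ vlookup a i
  lookup-xPos a b c γ i = trans (lookup-++ˡ ((a ++ b) ++ c) γ (xIdx i))
    (trans (lookup-++ˡ (a ++ b) c (i ↑ˡ q)) (lookup-++ˡ a b i))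

  lookup-yPos : ∀ a b c (γ : Vec (Fin d) (q + r)) j → vlookup (((a ++ b) ++ c) ++ γ) (yPos j) ≡ vlookup b j
  lookup-yPos a b c γ j = trans (lookup-++ˡ ((a ++ b) ++ c) γ (yIdx j))
    (trans (lookup-++ˡ (a ++ b) c (p ↑ʳ j)) (lookup-++ʳ a b j))

  module FibreBlock (blockwise : BlockwiseDecomposable (sat pair))
                    {a₀ : Vec (Fin d) p} {b : Vec (Fin d) q} (sa₀b : T (support a₀ b))
                    (i : Fin p) (j : Fin q) where

    blocks : BlockwiseDecomposableIn (sat pair) (xPos i) (yPos j)
    blocks = blockwise (xPos i) (yPos j) (xPos≢yPos i j)
    open ProperBlock (proj₁ blocks)

    Entry : Fin d → Fin d → Set
    Entry = SelNonempty (sat pair) (xPos i) (yPos j)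

    entry : ∀ {γ} → T (sat pair γ) → Entry (vlookup γ (xPos i)) (vlookup γ (yPos j))
    entry s = _ , s , refl , refl

    diagonal : ∀ a c' → T (R ((a ++ b) ++ c')) → Entry (vlookup a i) (vlookup b j)
    diagonal a c' R₂ = subst₂ Entry (lookup-xPos a b c' (b ++ c') i) (lookup-yPos a b c' (b ++ c') j)
                         (entry (from (sat-pair a b c' b c') (R₂ , R₂)))

    block-of-b : ∃ λ ℓ → T (A ℓ (vlookup a₀ i)) × T (B ℓ (vlookup b j))
    block-of-b = let c₀ , R₀ = to (any-allVec⇔ _) sa₀b in blocks⇒ _ _ (diagonal a₀ c₀ R₀)

    ℓ : Fin k
    ℓ = proj₁ block-of-b

    InBlock : Vec (Fin d) (n + (q + r)) → Set
    InBlock γ = T (sat pair γ) × T (A ℓ (vlookup γ (xPos i))) × T (B ℓ (vlookup γ (yPos j)))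

    inBlock : ∀ a b₁ c c' → T (sat pair (((a ++ b₁) ++ c) ++ (b ++ c'))) →
              InBlock (((a ++ b₁) ++ c) ++ (b ++ c'))
    inBlock a b₁ c c' s = s , Aℓa , col∈block (proj₁ blocks) ℓ (entry s) Aℓa
      where
      Aℓa : T (A ℓ (vlookup (((a ++ b₁) ++ c) ++ (b ++ c')) (xPos i)))
      Aℓa = subst (T ∘ A ℓ) (sym (lookup-xPos a b₁ c (b ++ c') i))
              (row∈block (proj₁ blocks) ℓ (diagonal a c' (proj₂ (to (sat-pair a b₁ c b c') s)))
                         (proj₂ (proj₂ block-of-b)))

    fibre-inBlock : ∀ β c' → T (sat pair (β ++ (b ++ c'))) → InBlock (β ++ (b ++ c'))
    fibre-inBlock = ++-elim {m = p + q} {n = r} (++-elim {m = p} {n = q} inBlock)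

    V : Fin (n + (q + r)) → Bool
    V = proj₁ (proj₂ blocks ℓ)

    V-x : V (xPos i) ≡ true
    V-x = proj₁ (proj₂ (proj₂ blocks ℓ))

    V-y : V (yPos j) ≡ false
    V-y = proj₁ (proj₂ (proj₂ (proj₂ blocks ℓ)))

    V-decomposes : Decomposable InBlock V
    V-decomposes = proj₂ (proj₂ (proj₂ (proj₂ blocks ℓ)))

    mix-++-fibre : ∀ β β' c' c'' → mix V (β ++ (b ++ c')) (β' ++ (b ++ c''))
                   ≡ mix (V ∘ (_↑ˡ (q + r))) β β' ++ (b ++ mix (V ∘ (n ↑ʳ_) ∘ (q ↑ʳ_)) c' c'')
    mix-++-fibre β β' c' c'' = trans (mix-++ V β β' (b ++ c') (b ++ c''))
      (cong (mix (V ∘ (_↑ˡ (q + r))) β β' ++_)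
        (trans (mix-++ (V ∘ (n ↑ʳ_)) b b c' c'')
               (cong (_++ mix (V ∘ (n ↑ʳ_) ∘ (q ↑ʳ_)) c' c'') (mix-idem _ b))))

    fibre-mixClosed : MixClosed (Fibre b) (V ∘ (_↑ˡ (q + r)))
    fibre-mixClosed β β' (c' , s) (c'' , s') =
      _ , subst (T ∘ sat pair) (mix-++-fibre β β' c' c'')
            (proj₁ (decomposable⇒mixClosed V-decomposes _ _ (fibre-inBlock β c' s) (fibre-inBlock β' c'' s')))

    fibre-mask : ∃ λ W → W (xIdx i) ≡ true × W (yIdx j) ≡ false × MixClosed (Fibre b) W
    fibre-mask = V ∘ (_↑ˡ (q + r)) , V-x , V-y , fibre-mixClosed

  mix-xy : ∀ {V} → (∀ i → V (xIdx i) ≡ true) → (∀ j → V (yIdx j) ≡ false) →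
           ∀ (a a' : Vec (Fin d) p) (b b' : Vec (Fin d) q) (c c' : Vec (Fin d) r) →
           mix V ((a ++ b) ++ c) ((a' ++ b') ++ c') ≡ (a ++ b') ++ mix (V ∘ ((p + q) ↑ʳ_)) c c'
  mix-xy {V} Vx Vy a a' b b' c c' = trans (mix-++ V (a ++ b) (a' ++ b') c c')
    (cong (_++ mix (V ∘ ((p + q) ↑ʳ_)) c c')
      (trans (mix-++ (V ∘ (_↑ˡ r)) a a' b b') (cong₂ _++_ (mix-true _ a a' Vx) (mix-false _ b b' Vy))))

  Exchange : Vec (Fin d) q → (Fin r → Bool) → Set
  Exchange b W = ∀ a a' b₁ b₂ c c' → T (support a b) → T (support a' b) →
                 T (R ((a ++ b₁) ++ c)) → T (R ((a' ++ b₂) ++ c')) → T (R ((a ++ b₂) ++ mix W c c'))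

  exchange : BlockwiseDecomposable (sat pair) → ∀ {a₀ b} → T (support a₀ b) → ∃ (Exchange b)
  exchange blockwise {a₀} {b} sa₀b
    with separating-pairwise {P = Fibre b} xIdx yIdx (λ i j → FibreBlock.fibre-mask blockwise sa₀b i j)
  ... | V , Vx , Vy , closed = V ∘ ((p + q) ↑ʳ_) , λ a a' b₁ b₂ c c' sab sa'b R₁ R₂ →
    fibre⁻ a b₂ _ (subst (Fibre b) (mix-xy Vx Vy a a' b₁ b₂ c c')
      (closed ((a ++ b₁) ++ c) ((a' ++ b₂) ++ c') (fibre⁺ b₁ c sab R₁) (fibre⁺ b₂ c' sa'b R₂)))

  module _ (blockwise : BlockwiseDecomposable (sat pair)) where

    support-rectangular : Rectangular support
    support-rectangular a a' b b' sab sa'b sab' =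
      let W , exchange-W = exchange blockwise sab
          c₁ , R₁ = to (any-allVec⇔ (λ c → R ((a' ++ b) ++ c))) sa'b
          c₂ , R₂ = to (any-allVec⇔ (λ c → R ((a ++ b') ++ c))) sab'
      in from (any-allVec⇔ (λ c → R ((a' ++ b') ++ c)))
              (mix W c₁ c₂ , exchange-W a' a b b' c₁ c₂ sa'b sab R₁ R₂)

    rank-one : ∀ a a' b b' → T (support a b) → T (support a' b) → N a b * N a' b' ≡ N a b' * N a' b
    rank-one a a' b b' sab sa'b = begin
      N a b * N a' b'
        ≡⟨ count-* (λ c → R ((a ++ b) ++ c)) (λ c' → R ((a' ++ b') ++ c')) ⟩
      ∑∑ r (λ c c' → ind (R ((a ++ b) ++ c) ∧ R ((a' ++ b') ++ c')))
        ≡⟨ ∑∑-mix r W _ ⟩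
      ∑∑ r (λ c c' → ind (R ((a ++ b) ++ mix W c c') ∧ R ((a' ++ b') ++ mix W c' c)))
        ≡⟨ ∑-cong (allVec d r) (λ c → ∑-cong (allVec d r) (λ c' → cong ind (exchanged c c'))) ⟩
      ∑∑ r (λ c c' → ind (R ((a ++ b') ++ c) ∧ R ((a' ++ b) ++ c')))
        ≡⟨ count-* (λ c → R ((a ++ b') ++ c)) (λ c' → R ((a' ++ b) ++ c')) ⟨
      N a b' * N a' b ∎
      where
      open ≡-Reasoning
      W : Fin r → Bool
      W = proj₁ (exchange blockwise sab)
      exchange-W : Exchange b W
      exchange-W = proj₂ (exchange blockwise sab)
      exchanged : ∀ c c' → R ((a ++ b) ++ mix W c c') ∧ R ((a' ++ b') ++ mix W c' c)
                           ≡ R ((a ++ b') ++ c) ∧ R ((a' ++ b) ++ c')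
      exchanged c c' = T-injective
        (λ both → let R₁ , R₂ = to T-∧ both in from T-∧
          ( subst (T ∘ R ∘ ((a ++ b') ++_)) (mix-mix W c c') (exchange-W a a' b b' _ _ sab sa'b R₁ R₂)
          , subst (T ∘ R ∘ ((a' ++ b) ++_)) (mix-mix W c' c) (exchange-W a' a b' b _ _ sa'b sab R₂ R₁)))
        (λ both → let R₁ , R₂ = to T-∧ both in from T-∧
          ( exchange-W a a' b' b c c' sab sa'b R₁ R₂
          , exchange-W a' a b b' c' c sa'b sab R₂ R₁))

    balanced : Balanced p q r R
    balanced = properBlock-resp-⇔ support⇔N≢0 blocks , λ ℓ a a' b b' Aℓa Aℓa' Bℓb _ →
      rank-one a a' b b' (blocks⇐ a b ℓ Aℓa Bℓb) (blocks⇐ a' b ℓ Aℓa' Bℓb)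
      where
      support⇔N≢0 : ∀ a b → T (support a b) ⇔ (N a b ≢ 0)
      support⇔N≢0 a b = any⇔∑-ind≢0 (λ c → R ((a ++ b) ++ c)) (allVec d r)
      blocks : ProperBlock (Vec (Fin d) p) (Vec (Fin d) q) (λ a b → T (support a b))
      blocks = RectangularBlocks.properBlock support support-rectangular
                 (allVec d p) ∈-allVec (allVec d q) ∈-allVec
      open ProperBlock blocks

lemma20 : (d : ℕ) (Γ : Language d) → StronglyBlockwiseDecomposable Γ → StronglyBalanced Γ
lemma20 d Γ blockwise p q r _ φ = balanced p q r φ (blockwise _ (pair p q r φ))
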